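{- Let $p,q$ be distinct propositional letters and let $M_{pq}=(W,V_{pq})$ be the inquisitive model with $W=\{w_1,w_2,w_3\}$ in which $p$ is true exactly at $w_1,w_2$, $q$ is true exactly at $w_2,w_3$, and every other propositional letter is true at no world. Let $\varphi(a,b)$ be a context (in the sense below) in which $p,q$ do not occur, and let $\varphi(=\!(p),=\!(q))$ be the result of replacing every occurrence of $a$ by $=\!(p)$ and every occurrence of $b$ by $=\!(q)$. Then $\varphi(=\!(p),=\!(q))$ is equivalent in $M_{pq}$ to one of the following formulas: $\top$; $(=\!(p)\land=\!(q))\otimes(=\!(p)\land=\!(q))$; $=\!(p)$; $=\!(q)$; $=\!(p)\land=\!(q)$; $\bot$.
   Context: Propositional dependence logic $\mathcal{D}$ has formulas $\varphi::= p\mid\neg p\mid\bot\mid=\!(p_1,\dots,p_n;q)\mid\varphi\land\varphi\mid\varphi\otimes\varphi$ with $p,q,p_i$ propositional letters (negation only in front of letters); $=\!(q)$ denotes the dependence atom with $n=0$ (constancy atom), and $\top$ abbreviates $p\otimes\neg p$. A context $\varphi(a,b)$ is a $\mathcal{D}$-formula in which the letters $a,b$ occur neither negated nor inside a dependence atom. Formulas are evaluated in inquisitive models $M=(W,V)$ at states $s\subseteq W$: $s\models p$ iff $p$ is true at every $w\in s$; $s\models\neg p$ iff $p$ is false at every $w\in s$; $s\models\bot$ iff $s=\emptyset$; $s\models\psi\land\chi$ iff both; $s\models\psi\otimes\chi$ iff $s=t_1\cup t_2$ with $t_1\models\psi$, $t_2\models\chi$; $s\models=\!(p_1,\dots,p_n;q)$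 iff any two worlds of $s$ agreeing on the truth values of $p_1,\dots,p_n$ agree on the truth value of $q$ (so $s\models=\!(q)$ iff $q$ has the same truth value at all worlds of $s$). Formulas $\psi,\chi$ are equivalent in $M$ iff they are supported by the same states $s\subseteq W$. -}

module Defs where

open import Data.Nat using (ℕ; _≟_)
open import Data.Bool using (Bool; true; false; if_then_else_)
open import Data.Fin using (Fin; zero; suc)
open import Data.Fin.Subset using (Subset; _∈_; _∪_; ⊥)
open import Data.List using (List; []; _∷_)
open import Data.List.Relation.Unary.All using (All)
open import Data.List.Relation.Unary.Any using (Any)
open import Data.Product using (Σ; _×_)
open import Data.Empty renaming (⊥ to Empty)
open import Data.Unit using (⊤)
open import Data.Sum using () renaming (_⊎_ to _⊎'_)
open import Relation.Binary.PropositionalEquality using (_≡_; _≢_)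
open import Relation.Nullary using (¬_; yes; no)

Letter : Set
Letter = ℕ

data Form : Set where
  lit  : Letter → Form
  neg  : Letter → Form
  bot  : Form
  dep  : List Letter → Letter → Form
  _∧ᶠ_ : Form → Form → Form
  _⊗_  : Form → Form → Form

con : Letter → Form
con q = dep [] q

top : Form
top = lit 0 ⊗ neg 0

-- Inquisitive models with finitely many worlds W = Fin n; states are subsets of W.
Valuation : ℕ → Set
Valuation n = Letter → Fin n → Bool

_,_⊨_ : ∀ {n} → Valuation n → Subset n → Form → Set
V , s ⊨ lit p = ∀ w → w ∈ s → V p w ≡ true
V , s ⊨ neg p = ∀ w → w ∈ s → V p w ≡ false
V , s ⊨ bot = s ≡ ⊥
V , s ⊨ dep ps q = ∀ w v → w ∈ s → v ∈ s →
  All (λ r → V r w ≡ V r v) ps → V q w ≡ V q v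
V , s ⊨ (φ ∧ᶠ ψ) = (V , s ⊨ φ) × (V , s ⊨ ψ)
V , s ⊨ (φ ⊗ ψ) = Σ (Subset _) λ t₁ → Σ (Subset _) λ t₂ →
  (s ≡ t₁ ∪ t₂) × (V , t₁ ⊨ φ) × (V , t₂ ⊨ ψ)

Equiv : ∀ {n} → Valuation n → Form → Form → Set
Equiv {n} V φ ψ = (s : Subset n) → ((V , s ⊨ φ) → (V , s ⊨ ψ)) × ((V , s ⊨ ψ) → (V , s ⊨ φ))

Occurs : Letter → Form → Set
Occurs l (lit p) = l ≡ p
Occurs l (neg p) = l ≡ p
Occurs l bot = Empty
Occurs l (dep ps q) = Any (l ≡_) ps ⊎' (l ≡ q)
Occurs l (φ ∧ᶠ ψ) = Occurs l φ ⊎' Occurs l ψ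
Occurs l (φ ⊗ ψ) = Occurs l φ ⊎' Occurs l ψ

Positive : Letter → Form → Set
Positive l (lit p) = ⊤
Positive l (neg p) = l ≢ p
Positive l bot = ⊤
Positive l (dep ps q) = ¬ Any (l ≡_) ps × l ≢ q
Positive l (φ ∧ᶠ ψ) = Positive l φ × Positive l ψ
Positive l (φ ⊗ ψ) = Positive l φ × Positive l ψ

IsContext : Letter → Letter → Form → Set
IsContext a b φ = Positive a φ × Positive b φ

substAB : Letter → Letter → Form → Form → Form → Form
substAB a b χ θ (lit p) with p ≟ a
... | yes _ = χ
... | no _ with p ≟ b
...   | yes _ = θ
...   | no _ = lit p
substAB a b χ θ (neg p) = neg p
substAB a b χ θ bot = bot
substAB a b χ θ (dep ps q) = dep ps q
substAB a b χ θ (φ ∧ᶠ ψ) = substAB a b χ θ φ ∧ᶠ substAB a b χ θ ψ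
substAB a b χ θ (φ ⊗ ψ) = substAB a b χ θ φ ⊗ substAB a b χ θ ψ

V-pq : Letter → Letter → Valuation 3
V-pq p q l w with l ≟ p
V-pq p q l zero | yes _ = true
V-pq p q l (suc zero) | yes _ = true
V-pq p q l (suc (suc zero)) | yes _ = false
V-pq p q l w | no _ with l ≟ q
V-pq p q l zero | no _ | yes _ = false
V-pq p q l (suc zero) | no _ | yes _ = true
V-pq p q l (suc (suc zero)) | no _ | yes _ = true
V-pq p q l w | no _ | no _ = false

-- In M_pq every letter other than p and q is false at all worlds, so an atom of φ(=(p),=(q))
-- is supported either by every state (negated letters, dependence atoms), only by ∅
-- (unnegated letters), or by exactly the states supporting =(p) resp. =(q). The support
-- families of the six listed formulas are closed, over the eight states of M_pq, under
-- intersection (∧) and pairwise unions (⊗); this finite closure is checked by computation,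
-- and induction on φ then places φ(=(p),=(q)) in one of the six families.
module Submission where

open import Defs
open import Data.Bool using (Bool; true; false; T; not; _∧_)
import Data.Bool.Properties as Bool
open import Data.Fin using (Fin; zero; suc)
open import Data.Fin.Properties using (all?)
open import Data.Fin.Subset using (Subset; _∈_; _∪_; _∩_; ∁; ⊤; inside; outside)
  renaming (⊥ to ∅)
open import Data.Fin.Subset.Properties
  using ( _∈?_; anySubset?; Empty-unique; ∉⊥; x∈p∩q⁻; x∈∁p⇒x∉p
        ; p∪∁p≡⊤; ∩-identityʳ; ∩-distribˡ-∪)
open import Data.List.Relation.Unary.All using (All)
open import Data.Nat using (ℕ; _≟_)
open import Data.Product using (∃; _×_; _,_; proj₂)
open import Data.Sum using (_⊎_; inj₁; inj₂)
open import Data.Vec using (_∷_; []; tabulate; lookup)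
open import Data.Vec.Properties using (≡-dec; []=⇒lookup; lookup⇒[]=; lookup∘tabulate)
open import Function using (_∘_; const)
open import Function.Bundles using (module Equivalence)
open import Relation.Binary.PropositionalEquality
  using (_≡_; _≢_; _≗_; refl; sym; trans; cong; subst; module ≡-Reasoning)
open import Relation.Nullary using (¬_; contradiction)
open import Relation.Nullary.Decidable
  using (Dec; yes; no; map′; ⌊_⌋; T?; _×-dec_; _→-dec_; toWitness; fromWitness)
open import Relation.Unary using (Pred; Decidable)

open Equivalence using (to; from)

infix 4 _≟ₛ_
_≟ₛ_ : ∀ {n} (s t : Subset n) → Dec (s ≡ t)
_≟ₛ_ = ≡-dec Bool._≟_

allSubset? : ∀ {n ℓ} {P : Pred (Subset n) ℓ} → Decidable P → Dec (∀ s → P s)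
allSubset? {ℕ.zero} P? = map′ (λ { p [] → p }) (λ ∀P → ∀P []) (P? [])
allSubset? {ℕ.suc n} P? =
  map′ (λ { (pᵢ , pₒ) (inside ∷ s) → pᵢ s ; (pᵢ , pₒ) (outside ∷ s) → pₒ s })
       (λ ∀P → ∀P ∘ (inside ∷_) , ∀P ∘ (outside ∷_))
       (allSubset? (P? ∘ (inside ∷_)) ×-dec allSubset? (P? ∘ (outside ∷_)))

ConstantOn : ∀ {n} → (Fin n → Bool) → Subset n → Set
ConstantOn f s = ∀ w v → w ∈ s → v ∈ s → f w ≡ f v

constantOn? : ∀ {n} (f : Fin n → Bool) → Decidable (ConstantOn f)
constantOn? f s = all? λ w → all? λ v → w ∈? s →-dec v ∈? s →-dec f w Bool.≟ f v

Splits : ∀ {n} → (Subset n → Bool) → (Subset n → Bool) → Subset n → Set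
Splits P Q s = ∃ λ t₁ → ∃ λ t₂ → s ≡ t₁ ∪ t₂ × T (P t₁) × T (Q t₂)

splits? : ∀ {n} (P Q : Subset n → Bool) → Decidable (Splits P Q)
splits? P Q s =
  anySubset? λ t₁ → anySubset? λ t₂ → s ≟ₛ t₁ ∪ t₂ ×-dec T? (P t₁) ×-dec T? (Q t₂)

_⊛_ : ∀ {n} → (Subset n → Bool) → (Subset n → Bool) → Subset n → Bool
(P ⊛ Q) s = ⌊ splits? P Q s ⌋

record Denotes {n} (V : Valuation n) (φ : Form) (P : Subset n → Bool) : Set where
  constructor mkDenotes
  field
    ⊨⇒T : ∀ {s} → V , s ⊨ φ → T (P s)
    T⇒⊨ : ∀ {s} → T (P s) → V , s ⊨ φ

open Denotes

module _ {n : ℕ} {V : Valuation n} where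

  Denotes-resp-≗ : ∀ {φ P Q} → P ≗ Q → Denotes V φ P → Denotes V φ Q
  Denotes-resp-≗ P≗Q d =
    mkDenotes (λ {s} → subst T (P≗Q s) ∘ ⊨⇒T d) (λ {s} → T⇒⊨ d ∘ subst T (sym (P≗Q s)))

  Denotes⇒Equiv : ∀ {φ ψ P} → Denotes V φ P → Denotes V ψ P → Equiv V φ ψ
  Denotes⇒Equiv dφ dψ s = T⇒⊨ dψ ∘ ⊨⇒T dφ , T⇒⊨ dφ ∘ ⊨⇒T dψ

  valid⇒Denotes-true : ∀ {φ} → (∀ s → V , s ⊨ φ) → Denotes V φ (const true)
  valid⇒Denotes-true valid = mkDenotes _ (λ {s} _ → valid s)

  top-valid : ∀ s → V , s ⊨ top
  top-valid s = s ∩ P , s ∩ ∁ P , s≡split , ∈P⇒true , ∈∁P⇒false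
    where
    P = tabulate (V 0)
    open ≡-Reasoning
    s≡split : s ≡ (s ∩ P) ∪ (s ∩ ∁ P)
    s≡split = begin
      s                    ≡⟨ sym (∩-identityʳ s) ⟩
      s ∩ ⊤                ≡⟨ cong (s ∩_) (sym (p∪∁p≡⊤ P)) ⟩
      s ∩ (P ∪ ∁ P)        ≡⟨ ∩-distribˡ-∪ s P (∁ P) ⟩
      (s ∩ P) ∪ (s ∩ ∁ P)  ∎
    lookup-P : ∀ w → lookup P w ≡ V 0 w
    lookup-P = lookup∘tabulate (V 0)
    ∈P⇒true : ∀ w → w ∈ s ∩ P → V 0 w ≡ true
    ∈P⇒true w w∈ = trans (sym (lookup-P w)) ([]=⇒lookup (proj₂ (x∈p∩q⁻ s P w∈)))
    ∈∁P⇒false : ∀ w → w ∈ s ∩ ∁ P → V 0 w ≡ false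
    ∈∁P⇒false w w∈ = Bool.¬-not λ V0w≡true →
      x∈∁p⇒x∉p (proj₂ (x∈p∩q⁻ s (∁ P) w∈)) (lookup⇒[]= w P (trans (lookup-P w) V0w≡true))

  top-denotes : Denotes V top (const true)
  top-denotes = valid⇒Denotes-true top-valid

  bot-denotes : Denotes V bot (λ s → ⌊ s ≟ₛ ∅ ⌋)
  bot-denotes = mkDenotes fromWitness toWitness

  lit-denotes-empty : ∀ r → V r ≗ const false → Denotes V (lit r) (λ s → ⌊ s ≟ₛ ∅ ⌋)
  lit-denotes-empty r Vr≗false = mkDenotes
    (λ s⊨r → fromWitness (Empty-unique λ (w , w∈s) →
       contradiction (trans (sym (Vr≗false w)) (s⊨r w w∈s)) λ ()))
    (λ s≡∅ w w∈s → contradiction (subst (w ∈_) (toWitness s≡∅) w∈s) ∉⊥)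

  neg-denotes : ∀ r → V r ≗ const false → Denotes V (neg r) (const true)
  neg-denotes r Vr≗false = valid⇒Denotes-true λ s w _ → Vr≗false w

  dep-denotes : ∀ ps r {b} → V r ≗ const b → Denotes V (dep ps r) (const true)
  dep-denotes ps r Vr≗b = valid⇒Denotes-true λ s w v _ _ _ → trans (Vr≗b w) (sym (Vr≗b v))

  con-denotes : ∀ r {f} → V r ≗ f → Denotes V (con r) (λ s → ⌊ constantOn? f s ⌋)
  con-denotes r Vr≗f = mkDenotes
    (λ s⊨con → fromWitness λ w v w∈s v∈s →
       trans (sym (Vr≗f w)) (trans (s⊨con w v w∈s v∈s All.[]) (Vr≗f v)))
    (λ f-const w v w∈s v∈s _ →
       trans (Vr≗f w) (trans (toWitness f-const w v w∈s v∈s) (sym (Vr≗f v))))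

  ∧-denotes : ∀ {φ ψ P Q} → Denotes V φ P → Denotes V ψ Q →
              Denotes V (φ ∧ᶠ ψ) (λ s → P s ∧ Q s)
  ∧-denotes dφ dψ = mkDenotes
    (λ (h₁ , h₂) → from Bool.T-∧ (⊨⇒T dφ h₁ , ⊨⇒T dψ h₂))
    (λ h → let h₁ , h₂ = to Bool.T-∧ h in T⇒⊨ dφ h₁ , T⇒⊨ dψ h₂)

  ⊗-denotes : ∀ {φ ψ P Q} → Denotes V φ P → Denotes V ψ Q → Denotes V (φ ⊗ ψ) (P ⊛ Q)
  ⊗-denotes {P = P} {Q} dφ dψ = mkDenotes
    (λ (t₁ , t₂ , s≡ , h₁ , h₂) → fromWitness (t₁ , t₂ , s≡ , ⊨⇒T dφ h₁ , ⊨⇒T dψ h₂))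
    (λ {s} h → let t₁ , t₂ , s≡ , h₁ , h₂ = toWitness {a? = splits? P Q s} h
               in t₁ , t₂ , s≡ , T⇒⊨ dφ h₁ , T⇒⊨ dψ h₂)

pᵛ qᵛ : Fin 3 → Bool
pᵛ zero             = true
pᵛ (suc zero)       = true
pᵛ (suc (suc zero)) = false
qᵛ zero             = false
qᵛ (suc zero)       = true
qᵛ (suc (suc zero)) = true

V-pq-p : ∀ p q → V-pq p q p ≗ pᵛ
V-pq-p p q w with p ≟ p
... | no p≢p = contradiction refl p≢p
V-pq-p p q zero             | yes _ = refl
V-pq-p p q (suc zero)       | yes _ = refl
V-pq-p p q (suc (suc zero)) | yes _ = refl

V-pq-q : ∀ {p q} → p ≢ q → V-pq p q q ≗ qᵛ
V-pq-q {p} {q} p≢q w with q ≟ p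
... | yes q≡p = contradiction (sym q≡p) p≢q
... | no _ with q ≟ q
...   | no q≢q = contradiction refl q≢q
V-pq-q p≢q zero             | no _ | yes _ = refl
V-pq-q p≢q (suc zero)       | no _ | yes _ = refl
V-pq-q p≢q (suc (suc zero)) | no _ | yes _ = refl

V-pq-other : ∀ {p q r} → p ≢ r → q ≢ r → V-pq p q r ≗ const false
V-pq-other {p} {q} {r} p≢r q≢r w with r ≟ p
... | yes r≡p = contradiction (sym r≡p) p≢r
... | no _ with r ≟ q
...   | yes r≡q = contradiction (sym r≡q) q≢r
V-pq-other p≢r q≢r zero             | no _ | no _ = refl
V-pq-other p≢r q≢r (suc zero)       | no _ | no _ = refl
V-pq-other p≢r q≢r (suc (suc zero)) | no _ | no _ = refl

data Class : Set where
  ⊤ᶜ ⊗ᶜ =pᶜ =qᶜ ∧ᶜ ⊥ᶜ : Class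

formula : Letter → Letter → Class → Form
formula p q ⊤ᶜ  = top
formula p q ⊗ᶜ  = formula p q ∧ᶜ ⊗ formula p q ∧ᶜ
formula p q =pᶜ = con p
formula p q =qᶜ = con q
formula p q ∧ᶜ  = con p ∧ᶠ con q
formula p q ⊥ᶜ  = bot

⟦_⟧ : Class → Subset 3 → Bool
⟦ ⊤ᶜ ⟧  s = true
-- =(p) ∧ =(q) holds only in ∅ and singletons, so two copies joined by ⊗ hold exactly in
-- the states with at most two worlds.
⟦ ⊗ᶜ ⟧  s = not ⌊ s ≟ₛ ⊤ ⌋
⟦ =pᶜ ⟧ s = ⌊ constantOn? pᵛ s ⌋
⟦ =qᶜ ⟧ s = ⌊ constantOn? qᵛ s ⌋
⟦ ∧ᶜ ⟧  s = ⟦ =pᶜ ⟧ s ∧ ⟦ =qᶜ ⟧ s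
⟦ ⊥ᶜ ⟧  s = ⌊ s ≟ₛ ∅ ⌋

-- Ordered by inclusion of their support families, the classes form the lattice
-- ⊥ᶜ < ∧ᶜ < =pᶜ, =qᶜ < ⊗ᶜ < ⊤ᶜ, and _⊓_ is its meet.
_⊓_ : Class → Class → Class
⊤ᶜ  ⊓ c   = c
⊥ᶜ  ⊓ c   = ⊥ᶜ
c   ⊓ ⊤ᶜ  = c
c   ⊓ ⊥ᶜ  = ⊥ᶜ
⊗ᶜ  ⊓ c   = c
c   ⊓ ⊗ᶜ  = c
=pᶜ ⊓ =pᶜ = =pᶜ
=qᶜ ⊓ =qᶜ = =qᶜ
_   ⊓ _   = ∧ᶜ

_⊔_ : Class → Class → Class
⊥ᶜ ⊔ c  = c
c  ⊔ ⊥ᶜ = c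
∧ᶜ ⊔ ∧ᶜ = ⊗ᶜ
_  ⊔ _  = ⊤ᶜ

allClasses? : ∀ {ℓ} {P : Pred Class ℓ} → Decidable P → Dec (∀ c → P c)
allClasses? P? =
  map′ (λ (t , g , p , q , a , b) → λ { ⊤ᶜ → t ; ⊗ᶜ → g ; =pᶜ → p ; =qᶜ → q ; ∧ᶜ → a ; ⊥ᶜ → b })
       (λ ∀P → ∀P ⊤ᶜ , ∀P ⊗ᶜ , ∀P =pᶜ , ∀P =qᶜ , ∀P ∧ᶜ , ∀P ⊥ᶜ)
       (P? ⊤ᶜ ×-dec P? ⊗ᶜ ×-dec P? =pᶜ ×-dec P? =qᶜ ×-dec P? ∧ᶜ ×-dec P? ⊥ᶜ)

⊓-correct : ∀ c₁ c₂ → ⟦ c₁ ⊓ c₂ ⟧ ≗ (λ s → ⟦ c₁ ⟧ s ∧ ⟦ c₂ ⟧ s)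
⊓-correct = toWitness {a? = allClasses? λ c₁ → allClasses? λ c₂ → allSubset? λ s →
                               ⟦ c₁ ⊓ c₂ ⟧ s Bool.≟ ⟦ c₁ ⟧ s ∧ ⟦ c₂ ⟧ s} _

⊔-correct : ∀ c₁ c₂ → ⟦ c₁ ⊔ c₂ ⟧ ≗ ⟦ c₁ ⟧ ⊛ ⟦ c₂ ⟧
⊔-correct = toWitness {a? = allClasses? λ c₁ → allClasses? λ c₂ → allSubset? λ s →
                               ⟦ c₁ ⊔ c₂ ⟧ s Bool.≟ (⟦ c₁ ⟧ ⊛ ⟦ c₂ ⟧) s} _

module _ {V : Valuation 3} {φ ψ : Form} (c₁ c₂ : Class) where

  ⊓-denotes : Denotes V φ ⟦ c₁ ⟧ → Denotes V ψ ⟦ c₂ ⟧ → Denotes V (φ ∧ᶠ ψ) ⟦ c₁ ⊓ c₂ ⟧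
  ⊓-denotes dφ dψ = Denotes-resp-≗ (sym ∘ ⊓-correct c₁ c₂) (∧-denotes dφ dψ)

  ⊔-denotes : Denotes V φ ⟦ c₁ ⟧ → Denotes V ψ ⟦ c₂ ⟧ → Denotes V (φ ⊗ ψ) ⟦ c₁ ⊔ c₂ ⟧
  ⊔-denotes dφ dψ = Denotes-resp-≗ (sym ∘ ⊔-correct c₁ c₂) (⊗-denotes dφ dψ)

module _ {p q : Letter} (p≢q : p ≢ q) where

  =p-denotes : Denotes (V-pq p q) (con p) ⟦ =pᶜ ⟧
  =p-denotes = con-denotes p (V-pq-p p q)

  =q-denotes : Denotes (V-pq p q) (con q) ⟦ =qᶜ ⟧
  =q-denotes = con-denotes q (V-pq-q p≢q)

  =p∧=q-denotes : Denotes (V-pq p q) (con p ∧ᶠ con q) ⟦ ∧ᶜ ⟧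
  =p∧=q-denotes = ∧-denotes =p-denotes =q-denotes

  formula-denotes : ∀ c → Denotes (V-pq p q) (formula p q c) ⟦ c ⟧
  formula-denotes ⊤ᶜ  = top-denotes
  formula-denotes ⊗ᶜ  = ⊔-denotes ∧ᶜ ∧ᶜ =p∧=q-denotes =p∧=q-denotes
  formula-denotes =pᶜ = =p-denotes
  formula-denotes =qᶜ = =q-denotes
  formula-denotes ∧ᶜ  = =p∧=q-denotes
  formula-denotes ⊥ᶜ  = bot-denotes

  classify : ∀ a b φ → ¬ Occurs p φ → ¬ Occurs q φ →
             ∃ λ c → Denotes (V-pq p q) (substAB a b (con p) (con q) φ) ⟦ c ⟧
  classify a b (lit r) p≢r q≢r with r ≟ a
  ... | yes _ = =pᶜ , =p-denotes
  ... | no _ with r ≟ b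
  ...   | yes _ = =qᶜ , =q-denotes
  ...   | no _ = ⊥ᶜ , lit-denotes-empty r (V-pq-other p≢r q≢r)
  classify a b (neg r) p≢r q≢r = ⊤ᶜ , neg-denotes r (V-pq-other p≢r q≢r)
  classify a b bot _ _ = ⊥ᶜ , bot-denotes
  classify a b (dep ps r) p∉ q∉ =
    ⊤ᶜ , dep-denotes ps r (V-pq-other (p∉ ∘ inj₂) (q∉ ∘ inj₂))
  classify a b (φ ∧ᶠ ψ) p∉ q∉ =
    let c₁ , d₁ = classify a b φ (p∉ ∘ inj₁) (q∉ ∘ inj₁)
        c₂ , d₂ = classify a b ψ (p∉ ∘ inj₂) (q∉ ∘ inj₂)
    in c₁ ⊓ c₂ , ⊓-denotes c₁ c₂ d₁ d₂
  classify a b (φ ⊗ ψ) p∉ q∉ =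
    let c₁ , d₁ = classify a b φ (p∉ ∘ inj₁) (q∉ ∘ inj₁)
        c₂ , d₂ = classify a b ψ (p∉ ∘ inj₂) (q∉ ∘ inj₂)
    in c₁ ⊔ c₂ , ⊔-denotes c₁ c₂ d₁ d₂

  equiv-formula : ∀ a b φ → ¬ Occurs p φ → ¬ Occurs q φ →
                  ∃ λ c → Equiv (V-pq p q) (substAB a b (con p) (con q) φ) (formula p q c)
  equiv-formula a b φ p∉ q∉ =
    let c , d = classify a b φ p∉ q∉ in c , Denotes⇒Equiv d (formula-denotes c)

lemma4p2 : (p q a b : Letter) → p ≢ q → a ≢ b → (φ : Form) →
    IsContext a b φ → ¬ Occurs p φ → ¬ Occurs q φ →
    let M = V-pq p q
        ψ = substAB a b (con p) (con q) φ
    in Equiv M ψ top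
       ⊎ Equiv M ψ ((con p ∧ᶠ con q) ⊗ (con p ∧ᶠ con q))
       ⊎ Equiv M ψ (con p)
       ⊎ Equiv M ψ (con q)
       ⊎ Equiv M ψ (con p ∧ᶠ con q)
       ⊎ Equiv M ψ bot
lemma4p2 p q a b p≢q _ φ _ p∉φ q∉φ with equiv-formula p≢q a b φ p∉φ q∉φ
... | ⊤ᶜ  , e = inj₁ e
... | ⊗ᶜ  , e = inj₂ (inj₁ e)
... | =pᶜ , e = inj₂ (inj₂ (inj₁ e))
... | =qᶜ , e = inj₂ (inj₂ (inj₂ (inj₁ e)))
... | ∧ᶜ  , e = inj₂ (inj₂ (inj₂ (inj₂ (inj₁ e))))
... | ⊥ᶜ  , e = inj₂ (inj₂ (inj₂ (inj₂ (inj₂ e))))
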